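{- For every integer $n\geq 3$, the $n$-barbell graph $B_n$ is antimagic.
   Context: All graphs are simple, finite and undirected. For a graph $G$ with $q$ edges, an antimagic labeling is a bijection $f:E(G)\to\{1,2,\dots,q\}$ such that the vertex sums $w(u)=\sum_{e\ni u} f(e)$ (sum over the edges incident to $u$) are pairwise distinct over all vertices $u\in V(G)$. A graph is antimagic if it admits an antimagic labeling. The $n$-barbell graph $B_n$ ($n\geq 3$) is obtained from two vertex-disjoint copies of the complete graph $K_n$ by adding one edge joining a vertex of the first copy to a vertex of the second copy. -}

module Defs where

open import Data.Nat using (ℕ; zero; suc; _<ᵇ_)
open import Data.Bool using (if_then_else_)
open import Data.Fin using (Fin; toℕ) renaming (zero to fzero; suc to fsuc)
open import Data.List using (List; []; _∷_; _++_; length; map; concatMap; lookup; allFin)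
open import Data.Nat.ListAction using (sum)
open import Data.Product using (_×_; _,_; proj₁; proj₂; Σ)
open import Relation.Binary.PropositionalEquality using (_≡_)
open import Relation.Binary using (DecidableEquality)
open import Relation.Nullary using (yes; no)
open import Function.Definitions using (Injective; Bijective)

-- A finite graph: vertex type with decidable equality and a list of edges,
-- each edge given by its two endpoints.  (Simple graphs are the ones whose
-- edge list has no loops and no repeated unordered pairs; B_n below is one.)
record Graph : Set₁ where
  field
    Vertex : Set
    _≟V_   : DecidableEquality Vertex
    edges  : List (Vertex × Vertex)

open Graph public

nE : Graph → ℕ
nE G = length (edges G)

edgeAt : (G : Graph) → Fin (nE G) → Vertex G × Vertex G
edgeAt G e = lookup (edges G) e

incidentLabel : (G : Graph) → (Fin (nE G) → ℕ) → Vertex G → Fin (nE G) → ℕ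
incidentLabel G lab u e with _≟V_ G u (proj₁ (edgeAt G e)) | _≟V_ G u (proj₂ (edgeAt G e))
... | yes _ | _     = lab e
... | no _  | yes _ = lab e
... | no _  | no _  = 0

-- vertex sum w(u) = Σ_{e ∋ u} f(e), where edge e gets the label 1 + toℕ (f e)
-- (so f : Fin q → Fin q bijective corresponds to a bijection E → {1,…,q})
vertexSum : (G : Graph) → (Fin (nE G) → Fin (nE G)) → Vertex G → ℕ
vertexSum G f u = sum (map (incidentLabel G (λ e → suc (toℕ (f e))) u) (allFin (nE G)))

IsAntimagicLabeling : (G : Graph) → (Fin (nE G) → Fin (nE G)) → Set
IsAntimagicLabeling G f = Bijective _≡_ _≡_ f × Injective _≡_ _≡_ (vertexSum G f)

Antimagic : Graph → Set
Antimagic G = Σ (Fin (nE G) → Fin (nE G)) (IsAntimagicLabeling G)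

pairs : (n : ℕ) → List (Fin n × Fin n)
pairs n = concatMap (λ i → concatMap (λ j → if toℕ i <ᵇ toℕ j then (i , j) ∷ [] else []) (allFin n)) (allFin n)

-- vertices of B_n: (c , i) = vertex i of copy c (c ∈ {0,1}, i ∈ Fin n)
BVertex : ℕ → Set
BVertex n = Fin 2 × Fin n

decBV : (n : ℕ) → DecidableEquality (BVertex n)
decBV n (c , i) (d , j) with c Data.Fin.≟ d | i Data.Fin.≟ j
... | yes Relation.Binary.PropositionalEquality.refl | yes Relation.Binary.PropositionalEquality.refl = yes Relation.Binary.PropositionalEquality.refl
... | no c≢d | _ = no (λ { Relation.Binary.PropositionalEquality.refl → c≢d Relation.Binary.PropositionalEquality.refl })
... | yes _ | no i≢j = no (λ { Relation.Binary.PropositionalEquality.refl → i≢j Relation.Binary.PropositionalEquality.refl })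

barbell : (n : ℕ) → Graph
barbell zero = record { Vertex = BVertex zero ; _≟V_ = decBV zero ; edges = [] }
barbell (suc m) = record
  { Vertex = BVertex (suc m)
  ; _≟V_  = decBV (suc m)
  ; edges = map (λ p → ((fzero , proj₁ p) , (fzero , proj₂ p))) (pairs (suc m))
         ++ map (λ p → ((fsuc fzero , proj₁ p) , (fsuc fzero , proj₂ p))) (pairs (suc m))
         ++ (((fzero , fzero) , (fsuc fzero , fzero)) ∷ [])
  }

-- Label the edges in reverse list order (the labeling `opposite`): the clique of copy 0
-- gets the largest labels, the clique of copy 1 the next ones, and the bridge label 1.
-- The edges of K_n are listed lexicographically, so deleting vertex 0 leaves K_(n-1)
-- listed in the same order; by induction the sum at vertex v strictly decreases in v
-- once n ≥ 3.  The bridge adds 1 only at vertex 0, which already has the largest sum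
-- in its copy.  Finally each vertex of copy 0 sees n - 1 labels above |E(K_n)| + 1,
-- while each sum in copy 1 is at most (n - 1)(|E(K_n)| + 1) + 1, so the two copies
-- have disjoint sets of sums.
module Submission where

open import Defs
open import Data.Bool using (true; false; _∨_; if_then_else_)
open import Data.Nat using (ℕ; zero; suc; _<ᵇ_; _+_; _*_; _∸_; _≤_; _<_; _≥_; z≤n; s≤s)
open import Data.Nat.Properties hiding (_≟_; suc-injective)
open import Data.Fin using (Fin; toℕ; opposite; _≟_) renaming (zero to fzero; suc to fsuc)
open import Data.Fin.Properties using (toℕ<n; toℕ-injective; opposite-prop; suc-injective)
open import Data.Fin.Permutation using (reverse)
open import Data.List using (List; []; _∷_; [_]; _++_; length; map; concatMap; lookup; allFin; tabulate)
open import Data.List.Properties using (length-++; length-map; map-tabulate; tabulate-cong; length-tabulate; concatMap-map; concatMap-cong; concatMap-pure; map-concatMap)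
open import Data.Nat.ListAction using (sum)
open import Data.Product using (_×_; _,_; proj₁; proj₂)
open import Data.Product.Properties using (,-injectiveˡ; ,-injectiveʳ)
open import Data.Bool.Properties using (∨-identityʳ)
open import Function using (_∘_; mk⇔)
open import Function.Bundles using (Bijection)
open import Function.Definitions using (Bijective; Injective)
open import Function.Properties.Inverse using (↔⇒⤖)
open import Relation.Binary using (DecidableEquality; tri<; tri≈; tri>)
open import Relation.Binary.PropositionalEquality using (_≡_; _≢_; refl; sym; trans; cong; cong₂; subst₂; module ≡-Reasoning)
open import Relation.Nullary using (yes; no; does; contradiction)
open import Relation.Nullary.Decidable using (dec-true; dec-false; does-⇔)

-- The element followed by k others in the list has rank b + k + 1; with b = 0
-- these ranks are exactly the labels assigned by the labeling `opposite`.
rankSum : {A : Set} → (A → ℕ) → ℕ → List A → ℕ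
rankSum χ b []       = 0
rankSum χ b (x ∷ xs) = χ x * (b + suc (length xs)) + rankSum χ b xs

module _ {A : Set} where

  rankSum-++ : (χ : A → ℕ) (b : ℕ) (xs ys : List A) →
               rankSum χ b (xs ++ ys) ≡ rankSum χ (b + length ys) xs + rankSum χ b ys
  rankSum-++ χ b []       ys = refl
  rankSum-++ χ b (x ∷ xs) ys = begin
    χ x * (b + suc (length (xs ++ ys))) + rankSum χ b (xs ++ ys)
      ≡⟨ cong₂ (λ r s → χ x * r + s) rank-eq (rankSum-++ χ b xs ys) ⟩
    χ x * (b + length ys + suc (length xs)) + (rankSum χ (b + length ys) xs + rankSum χ b ys)
      ≡⟨ sym (+-assoc (χ x * _) _ _) ⟩
    χ x * (b + length ys + suc (length xs)) + rankSum χ (b + length ys) xs + rankSum χ b ys ∎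
    where
    open ≡-Reasoning
    rank-eq : b + suc (length (xs ++ ys)) ≡ b + length ys + suc (length xs)
    rank-eq = begin
      b + suc (length (xs ++ ys))       ≡⟨ cong (λ l → b + suc l) (length-++ xs) ⟩
      b + suc (length xs + length ys)   ≡⟨ cong (λ l → b + suc l) (+-comm (length xs) (length ys)) ⟩
      b + suc (length ys + length xs)   ≡⟨ cong (b +_) (sym (+-suc (length ys) (length xs))) ⟩
      b + (length ys + suc (length xs)) ≡⟨ sym (+-assoc b (length ys) _) ⟩
      b + length ys + suc (length xs)   ∎

  rankSum-map : {B : Set} (χ : B → ℕ) (b : ℕ) (f : A → B) (xs : List A) →
                rankSum χ b (map f xs) ≡ rankSum (χ ∘ f) b xs
  rankSum-map χ b f []       = refl
  rankSum-map χ b f (x ∷ xs) =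
    cong₂ (λ l s → χ (f x) * (b + suc l) + s) (length-map f xs) (rankSum-map χ b f xs)

  rankSum-cong : {χ ψ : A → ℕ} (b : ℕ) → (∀ x → χ x ≡ ψ x) → (xs : List A) →
                 rankSum χ b xs ≡ rankSum ψ b xs
  rankSum-cong b χ≗ψ []       = refl
  rankSum-cong b χ≗ψ (x ∷ xs) = cong₂ (λ c s → c * _ + s) (χ≗ψ x) (rankSum-cong b χ≗ψ xs)

  rankSum-zero : {χ : A → ℕ} (b : ℕ) → (∀ x → χ x ≡ 0) → (xs : List A) → rankSum χ b xs ≡ 0
  rankSum-zero b χ≗0 []       = refl
  rankSum-zero b χ≗0 (x ∷ xs) = cong₂ (λ c s → c * _ + s) (χ≗0 x) (rankSum-zero b χ≗0 xs)

rankTotal : ℕ → ℕ → ℕ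
rankTotal b zero    = 0
rankTotal b (suc m) = b + suc m + rankTotal b m

rankSum-one : {A : Set} {χ : A → ℕ} (b : ℕ) → (∀ x → χ x ≡ 1) → (xs : List A) →
              rankSum χ b xs ≡ rankTotal b (length xs)
rankSum-one b χ≗1 []       = refl
rankSum-one b χ≗1 (x ∷ xs) =
  cong₂ _+_ (trans (cong (_* _) (χ≗1 x)) (*-identityˡ _)) (rankSum-one b χ≗1 xs)

allFin-suc : (m : ℕ) → allFin (suc m) ≡ fzero ∷ map fsuc (allFin m)
allFin-suc m = cong (fzero ∷_) (sym (map-tabulate (λ i → i) fsuc))

length-allFin : (m : ℕ) → length (allFin m) ≡ m
length-allFin m = length-tabulate (λ i → i)

rankSum-allFin-suc : {m : ℕ} (χ : Fin (suc m) → ℕ) (b : ℕ) →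
  rankSum χ b (allFin (suc m)) ≡ χ fzero * (b + suc m) + rankSum (χ ∘ fsuc) b (allFin m)
rankSum-allFin-suc {m} χ b = begin
  rankSum χ b (allFin (suc m))
    ≡⟨ cong (rankSum χ b) (allFin-suc m) ⟩
  χ fzero * (b + suc (length (map fsuc (allFin m)))) + rankSum χ b (map fsuc (allFin m))
    ≡⟨ cong₂ (λ l s → χ fzero * (b + suc l) + s)
             (trans (length-map fsuc (allFin m)) (length-allFin m)) (rankSum-map χ b fsuc (allFin m)) ⟩
  χ fzero * (b + suc m) + rankSum (χ ∘ fsuc) b (allFin m) ∎
  where open ≡-Reasoning

rankSum-allFin-single : {m : ℕ} {χ : Fin m → ℕ} (b : ℕ) (j₀ : Fin m) →
  χ j₀ ≡ 1 → (∀ j → j ≢ j₀ → χ j ≡ 0) → rankSum χ b (allFin m) ≡ b + (m ∸ toℕ j₀)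
rankSum-allFin-single {suc m} {χ} b fzero χ0≡1 χj≡0 = begin
  rankSum χ b (allFin (suc m))                            ≡⟨ rankSum-allFin-suc χ b ⟩
  χ fzero * (b + suc m) + rankSum (χ ∘ fsuc) b (allFin m) ≡⟨ cong₂ _+_ (cong (_* (b + suc m)) χ0≡1) tail≡0 ⟩
  1 * (b + suc m) + 0                                     ≡⟨ trans (+-identityʳ _) (*-identityˡ _) ⟩
  b + suc m                                               ∎
  where
  open ≡-Reasoning
  tail≡0 : rankSum (χ ∘ fsuc) b (allFin m) ≡ 0
  tail≡0 = rankSum-zero b (λ j → χj≡0 (fsuc j) (λ ())) (allFin m)
rankSum-allFin-single {suc m} {χ} b (fsuc j₀) χj₀≡1 χj≡0 = begin
  rankSum χ b (allFin (suc m))                            ≡⟨ rankSum-allFin-suc χ b ⟩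
  χ fzero * (b + suc m) + rankSum (χ ∘ fsuc) b (allFin m) ≡⟨ cong₂ _+_ (cong (_* (b + suc m)) (χj≡0 fzero (λ ()))) tail ⟩
  b + (m ∸ toℕ j₀)                                        ∎
  where
  open ≡-Reasoning
  tail : rankSum (χ ∘ fsuc) b (allFin m) ≡ b + (m ∸ toℕ j₀)
  tail = rankSum-allFin-single b j₀ χj₀≡1 (λ j j≢j₀ → χj≡0 (fsuc j) (j≢j₀ ∘ suc-injective))

incidence : {V : Set} → DecidableEquality V → V → V × V → ℕ
incidence _≟_ u (a , b) = if does (u ≟ a) ∨ does (u ≟ b) then 1 else 0

module _ {V : Set} (_≟_ : DecidableEquality V) where

  incidence-≡ˡ : (u b : V) → incidence _≟_ u (u , b) ≡ 1
  incidence-≡ˡ u b rewrite dec-true (u ≟ u) refl = refl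

  incidence-≡ʳ : (u a : V) → incidence _≟_ u (a , u) ≡ 1
  incidence-≡ʳ u a with does (u ≟ a)
  ... | true  = refl
  ... | false rewrite dec-true (u ≟ u) refl = refl

  incidence-≢ : (u a b : V) → u ≢ a → u ≢ b → incidence _≟_ u (a , b) ≡ 0
  incidence-≢ u a b u≢a u≢b rewrite dec-false (u ≟ a) u≢a | dec-false (u ≟ b) u≢b = refl

  incidence-injective : {W : Set} (_≟′_ : DecidableEquality W) (f : V → W) →
    (∀ {x y} → f x ≡ f y → x ≡ y) → (u a b : V) →
    incidence _≟′_ (f u) (f a , f b) ≡ incidence _≟_ u (a , b)
  incidence-injective _≟′_ f f-inj u a b =
    cong₂ (λ p q → if p ∨ q then 1 else 0) (transport a) (transport b)
    where
    transport : (x : V) → does (f u ≟′ f x) ≡ does (u ≟ x)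
    transport x = does-⇔ (mk⇔ f-inj (cong f)) (f u ≟′ f x) (u ≟ x)

incidentLabel-incidence : (G : Graph) (lab : Fin (nE G) → ℕ) (u : Vertex G) (e : Fin (nE G)) →
  incidentLabel G lab u e ≡ incidence (_≟V_ G) u (edgeAt G e) * lab e
incidentLabel-incidence G lab u e with _≟V_ G u (proj₁ (edgeAt G e)) | _≟V_ G u (proj₂ (edgeAt G e))
... | yes _ | _     = sym (+-identityʳ (lab e))
... | no _  | yes _ = sym (+-identityʳ (lab e))
... | no _  | no _  = refl

sum-tabulate-rank : {A : Set} (χ : A → ℕ) (xs : List A) →
  sum (tabulate (λ i → χ (lookup xs i) * (length xs ∸ toℕ i))) ≡ rankSum χ 0 xs
sum-tabulate-rank χ []       = refl
sum-tabulate-rank χ (x ∷ xs) = cong (χ x * suc (length xs) +_) (sum-tabulate-rank χ xs)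

vertexSum-opposite : (G : Graph) (u : Vertex G) →
  vertexSum G opposite u ≡ rankSum (incidence (_≟V_ G) u) 0 (edges G)
vertexSum-opposite G u = begin
  sum (map (incidentLabel G label u) (allFin (nE G)))
    ≡⟨ cong sum (map-tabulate (λ e → e) (incidentLabel G label u)) ⟩
  sum (tabulate (incidentLabel G label u))
    ≡⟨ cong sum (tabulate-cong (λ e → trans (incidentLabel-incidence G label u e)
                                            (cong (incidence (_≟V_ G) u (edgeAt G e) *_) (label-rank e)))) ⟩
  sum (tabulate (λ e → incidence (_≟V_ G) u (edgeAt G e) * (nE G ∸ toℕ e)))
    ≡⟨ sum-tabulate-rank (incidence (_≟V_ G) u) (edges G) ⟩
  rankSum (incidence (_≟V_ G) u) 0 (edges G) ∎
  where
  open ≡-Reasoning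
  label : Fin (nE G) → ℕ
  label e = suc (toℕ (opposite e))
  label-rank : (e : Fin (nE G)) → label e ≡ nE G ∸ toℕ e
  label-rank e = trans (cong suc (opposite-prop e)) (sym (+-∸-assoc 1 (toℕ<n e)))

opposite-bijective : (n : ℕ) → Bijective _≡_ _≡_ (opposite {n})
opposite-bijective n = Bijection.bijective (↔⇒⤖ (reverse {n}))

shift : {m : ℕ} → Fin m × Fin m → Fin (suc m) × Fin (suc m)
shift (i , j) = fsuc i , fsuc j

spoke : {m : ℕ} → Fin m → Fin (suc m) × Fin (suc m)
spoke j = fzero , fsuc j

star : (m : ℕ) → List (Fin (suc m) × Fin (suc m))
star m = map spoke (allFin m)

concatMap-allFin-suc : {A : Set} {m : ℕ} (f : Fin (suc m) → List A) →
  concatMap f (allFin (suc m)) ≡ f fzero ++ concatMap (f ∘ fsuc) (allFin m)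
concatMap-allFin-suc {m = m} f =
  trans (cong (concatMap f) (allFin-suc m)) (cong (f fzero ++_) (concatMap-map f fsuc (allFin m)))

pairIfLess : {m : ℕ} → Fin m → Fin m → List (Fin m × Fin m)
pairIfLess i j = if toℕ i <ᵇ toℕ j then (i , j) ∷ [] else []

pairsFrom : (m : ℕ) → Fin m → List (Fin m × Fin m)
pairsFrom m i = concatMap (pairIfLess i) (allFin m)

pairsFrom-zero : (m : ℕ) → pairsFrom (suc m) fzero ≡ star m
pairsFrom-zero m = begin
  pairsFrom (suc m) fzero                   ≡⟨ concatMap-allFin-suc (pairIfLess fzero) ⟩
  concatMap (λ j → spoke j ∷ []) (allFin m) ≡⟨ sym (concatMap-map [_] spoke (allFin m)) ⟩
  concatMap [_] (star m)                    ≡⟨ concatMap-pure (star m) ⟩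
  star m                                    ∎
  where open ≡-Reasoning

pairIfLess-suc : {m : ℕ} (i j : Fin m) → pairIfLess (fsuc i) (fsuc j) ≡ map shift (pairIfLess i j)
pairIfLess-suc i j with toℕ i <ᵇ toℕ j
... | true  = refl
... | false = refl

pairsFrom-suc : (m : ℕ) (i : Fin m) → pairsFrom (suc m) (fsuc i) ≡ map shift (pairsFrom m i)
pairsFrom-suc m i = begin
  pairsFrom (suc m) (fsuc i)                        ≡⟨ concatMap-allFin-suc (pairIfLess (fsuc i)) ⟩
  concatMap (pairIfLess (fsuc i) ∘ fsuc) (allFin m) ≡⟨ concatMap-cong (pairIfLess-suc i) (allFin m) ⟩
  concatMap (map shift ∘ pairIfLess i) (allFin m)   ≡⟨ sym (map-concatMap shift (pairIfLess i) (allFin m)) ⟩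
  map shift (pairsFrom m i)                         ∎
  where open ≡-Reasoning

pairs-suc : (m : ℕ) → pairs (suc m) ≡ star m ++ map shift (pairs m)
pairs-suc m = begin
  concatMap (pairsFrom (suc m)) (allFin (suc m))
    ≡⟨ concatMap-allFin-suc (pairsFrom (suc m)) ⟩
  pairsFrom (suc m) fzero ++ concatMap (pairsFrom (suc m) ∘ fsuc) (allFin m)
    ≡⟨ cong₂ _++_ (pairsFrom-zero m) (concatMap-cong (pairsFrom-suc m) (allFin m)) ⟩
  star m ++ concatMap (map shift ∘ pairsFrom m) (allFin m)
    ≡⟨ cong (star m ++_) (sym (map-concatMap shift (pairsFrom m) (allFin m))) ⟩
  star m ++ map shift (pairs m) ∎
  where open ≡-Reasoning

edgeCount : ℕ → ℕ
edgeCount m = length (pairs m)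

edgeCount-suc : (m : ℕ) → edgeCount (suc m) ≡ edgeCount m + m
edgeCount-suc m = begin
  length (pairs (suc m))                         ≡⟨ cong length (pairs-suc m) ⟩
  length (star m ++ map shift (pairs m))         ≡⟨ length-++ (star m) ⟩
  length (star m) + length (map shift (pairs m)) ≡⟨ cong₂ _+_ (trans (length-map spoke (allFin m)) (length-allFin m))
                                                             (length-map shift (pairs m)) ⟩
  m + edgeCount m                                ≡⟨ +-comm m _ ⟩
  edgeCount m + m                                ∎
  where open ≡-Reasoning

-- Under the labeling `opposite`, the part of the vertex sum at v coming from a copy
-- of K_m whose edges are followed by b further edges in the edge list.
rankedDegree : ℕ → (m : ℕ) → Fin m → ℕ
rankedDegree b m v = rankSum (incidence _≟_ v) b (pairs m)

rankedDegree-split : (b m : ℕ) (v : Fin (suc m)) →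
  rankedDegree b (suc m) v ≡
    rankSum (incidence _≟_ v ∘ spoke) (b + edgeCount m) (allFin m)
    + rankSum (incidence _≟_ v ∘ shift) b (pairs m)
rankedDegree-split b m v = begin
  rankSum χ b (pairs (suc m))
    ≡⟨ cong (rankSum χ b) (pairs-suc m) ⟩
  rankSum χ b (star m ++ map shift (pairs m))
    ≡⟨ rankSum-++ χ b (star m) (map shift (pairs m)) ⟩
  rankSum χ (b + length (map shift (pairs m))) (star m) + rankSum χ b (map shift (pairs m))
    ≡⟨ cong₂ _+_ (trans (cong (λ l → rankSum χ (b + l) (star m)) (length-map shift (pairs m)))
                        (rankSum-map χ _ _ (allFin m)))
                 (rankSum-map χ b shift (pairs m)) ⟩
  rankSum (χ ∘ spoke) (b + edgeCount m) (allFin m) + rankSum (χ ∘ shift) b (pairs m) ∎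
  where
  open ≡-Reasoning
  χ : Fin (suc m) × Fin (suc m) → ℕ
  χ = incidence _≟_ v

rankedDegree-zero : (b m : ℕ) → rankedDegree b (suc m) fzero ≡ rankTotal (b + edgeCount m) m
rankedDegree-zero b m = begin
  rankedDegree b (suc m) fzero
    ≡⟨ rankedDegree-split b m fzero ⟩
  rankSum (χ ∘ spoke) (b + edgeCount m) (allFin m) + rankSum (χ ∘ shift) b (pairs m)
    ≡⟨ cong₂ _+_ (rankSum-one _ (λ j → incidence-≡ˡ _≟_ fzero (fsuc j)) (allFin m))
                 (rankSum-zero b (λ (i , j) → incidence-≢ _≟_ fzero (fsuc i) (fsuc j) (λ ()) (λ ())) (pairs m)) ⟩
  rankTotal (b + edgeCount m) (length (allFin m)) + 0
    ≡⟨ trans (+-identityʳ _) (cong (rankTotal _) (length-allFin m)) ⟩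
  rankTotal (b + edgeCount m) m ∎
  where
  open ≡-Reasoning
  χ : Fin (suc m) × Fin (suc m) → ℕ
  χ = incidence _≟_ fzero

rankedDegree-suc : (b m : ℕ) (v : Fin m) →
  rankedDegree b (suc m) (fsuc v) ≡ b + edgeCount m + (m ∸ toℕ v) + rankedDegree b m v
rankedDegree-suc b m v = trans (rankedDegree-split b m (fsuc v)) (cong₂ _+_
  (rankSum-allFin-single (b + edgeCount m) v (incidence-≡ʳ _≟_ (fsuc v) fzero)
     (λ j j≢v → incidence-≢ _≟_ (fsuc v) fzero (fsuc j) (λ ()) (j≢v ∘ sym ∘ suc-injective)))
  (rankSum-cong b (λ (i , j) → incidence-injective _≟_ _≟_ fsuc suc-injective v i j) (pairs m)))

rankTotal-lower : (c m : ℕ) → m * (c + 1) ≤ rankTotal c m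
rankTotal-lower c zero    = z≤n
rankTotal-lower c (suc m) = +-mono-≤ (+-monoʳ-≤ c (s≤s z≤n)) (rankTotal-lower c m)

rankTotal-upper : (c m : ℕ) → rankTotal c m ≤ m * (c + m)
rankTotal-upper c zero    = z≤n
rankTotal-upper c (suc m) =
  +-monoʳ-≤ (c + suc m) (≤-trans (rankTotal-upper c m) (*-monoʳ-≤ m (+-monoʳ-≤ c (n≤1+n m))))

rankedDegree-lower : (b p : ℕ) (v : Fin (suc p)) → p * (b + 1) ≤ rankedDegree b (suc p) v
rankedDegree-lower b zero    fzero = z≤n
rankedDegree-lower b (suc p) fzero = begin
  suc p * (b + 1)                          ≤⟨ *-monoʳ-≤ (suc p) (+-monoˡ-≤ 1 (m≤m+n b _)) ⟩
  suc p * (b + edgeCount (suc p) + 1)      ≤⟨ rankTotal-lower _ (suc p) ⟩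
  rankTotal (b + edgeCount (suc p)) (suc p) ≡⟨ rankedDegree-zero b (suc p) ⟨
  rankedDegree b (suc (suc p)) fzero       ∎
  where open ≤-Reasoning
rankedDegree-lower b (suc p) (fsuc w) = begin
  b + 1 + p * (b + 1)
    ≤⟨ +-mono-≤ (+-monoʳ-≤ b (m<n⇒0<n∸m (toℕ<n w))) (rankedDegree-lower b p w) ⟩
  b + (suc p ∸ toℕ w) + rankedDegree b (suc p) w
    ≤⟨ +-monoˡ-≤ _ (+-monoˡ-≤ _ (m≤m+n b _)) ⟩
  b + edgeCount (suc p) + (suc p ∸ toℕ w) + rankedDegree b (suc p) w
    ≡⟨ rankedDegree-suc b (suc p) w ⟨
  rankedDegree b (suc (suc p)) (fsuc w) ∎
  where open ≤-Reasoning

+-edgeCount-suc : (b m : ℕ) → b + edgeCount m + m ≡ b + edgeCount (suc m)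
+-edgeCount-suc b m = trans (+-assoc b (edgeCount m) m) (cong (b +_) (sym (edgeCount-suc m)))

rankedDegree-upper : (b p : ℕ) (v : Fin (suc p)) → rankedDegree b (suc p) v ≤ p * (b + edgeCount (suc p))
rankedDegree-upper b zero    fzero = z≤n
rankedDegree-upper b (suc p) fzero = begin
  rankedDegree b (suc (suc p)) fzero        ≡⟨ rankedDegree-zero b (suc p) ⟩
  rankTotal (b + edgeCount (suc p)) (suc p) ≤⟨ rankTotal-upper _ (suc p) ⟩
  suc p * (b + edgeCount (suc p) + suc p)   ≡⟨ cong (suc p *_) (+-edgeCount-suc b (suc p)) ⟩
  suc p * (b + edgeCount (suc (suc p)))     ∎
  where open ≤-Reasoning
rankedDegree-upper b (suc p) (fsuc w) = begin
  rankedDegree b (suc (suc p)) (fsuc w)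
    ≡⟨ rankedDegree-suc b (suc p) w ⟩
  b + edgeCount (suc p) + (suc p ∸ toℕ w) + rankedDegree b (suc p) w
    ≤⟨ +-mono-≤ (+-monoʳ-≤ (b + edgeCount (suc p)) (m∸n≤m (suc p) (toℕ w))) (rankedDegree-upper b p w) ⟩
  b + edgeCount (suc p) + suc p + p * (b + edgeCount (suc p))
    ≤⟨ +-mono-≤ (≤-reflexive (+-edgeCount-suc b (suc p))) (*-monoʳ-≤ p (+-monoʳ-≤ b edgeCount-mono)) ⟩
  b + edgeCount (suc (suc p)) + p * (b + edgeCount (suc (suc p))) ∎
  where
  open ≤-Reasoning
  edgeCount-mono : edgeCount (suc p) ≤ edgeCount (suc (suc p))
  edgeCount-mono = ≤-trans (m≤m+n _ (suc p)) (≤-reflexive (sym (edgeCount-suc (suc p))))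

rankedDegree-suc+p≤zero : (b p : ℕ) (w : Fin (suc p)) →
  rankedDegree b (suc (suc p)) (fsuc w) + p ≤ rankedDegree b (suc (suc p)) fzero
rankedDegree-suc+p≤zero b p w = begin
  rankedDegree b (suc (suc p)) (fsuc w) + p
    ≡⟨ cong (_+ p) (rankedDegree-suc b (suc p) w) ⟩
  B + (suc p ∸ toℕ w) + rankedDegree b (suc p) w + p
    ≤⟨ +-monoˡ-≤ p (+-mono-≤ (+-monoʳ-≤ B (m∸n≤m (suc p) (toℕ w))) (rankedDegree-upper b p w)) ⟩
  B + suc p + p * B + p
    ≡⟨ +-assoc (B + suc p) (p * B) p ⟩
  B + suc p + (p * B + p)
    ≡⟨ cong (B + suc p +_) (trans (+-comm (p * B) p) (sym (*-suc p B))) ⟩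
  B + suc p + p * suc B
    ≤⟨ +-monoʳ-≤ (B + suc p) (≤-trans (≤-reflexive (cong (p *_) (+-comm 1 B))) (rankTotal-lower B p)) ⟩
  rankTotal B (suc p)
    ≡⟨ rankedDegree-zero b (suc p) ⟨
  rankedDegree b (suc (suc p)) fzero ∎
  where
  open ≤-Reasoning
  B : ℕ
  B = b + edgeCount (suc p)

rankedDegree-antitone : (b m : ℕ) (u v : Fin m) → toℕ u < toℕ v → rankedDegree b m v ≤ rankedDegree b m u
rankedDegree-antitone b (suc (suc p)) fzero (fsuc w) _ =
  ≤-trans (m≤m+n _ p) (rankedDegree-suc+p≤zero b p w)
rankedDegree-antitone b (suc m) (fsuc u) (fsuc w) (s≤s u<w) rewrite rankedDegree-suc b m u | rankedDegree-suc b m w =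
  +-mono-≤ (+-monoʳ-≤ (b + edgeCount m) (∸-monoʳ-≤ m (<⇒≤ u<w))) (rankedDegree-antitone b m u w u<w)

rankedDegree-strictlyAntitone : (b r : ℕ) (u v : Fin (3 + r)) → toℕ u < toℕ v →
  rankedDegree b (3 + r) v < rankedDegree b (3 + r) u
rankedDegree-strictlyAntitone b r fzero (fsuc w) _ =
  ≤-trans (m<m+n _ (s≤s z≤n)) (rankedDegree-suc+p≤zero b (suc r) w)
rankedDegree-strictlyAntitone b r (fsuc u) (fsuc w) (s≤s u<w) rewrite rankedDegree-suc b (2 + r) u | rankedDegree-suc b (2 + r) w =
  +-mono-<-≤ (+-monoʳ-< (b + edgeCount (2 + r)) (∸-monoʳ-< u<w (<⇒≤ (toℕ<n w))))
             (rankedDegree-antitone b (2 + r) u w u<w)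

bridgeBonus : {m : ℕ} → Fin (suc m) → ℕ
bridgeBonus v = if does (v ≟ fzero) then 1 else 0

bridgeBonus≤1 : {m : ℕ} (v : Fin (suc m)) → bridgeBonus v ≤ 1
bridgeBonus≤1 v with does (v ≟ fzero)
... | true  = ≤-refl
... | false = z≤n

copyScore : ℕ → (m : ℕ) → Fin (suc m) → ℕ
copyScore b m v = rankedDegree b (suc m) v + bridgeBonus v

module Barbell (k : ℕ) where

  inCopy : Fin 2 → Fin (suc k) × Fin (suc k) → BVertex (suc k) × BVertex (suc k)
  inCopy c (i , j) = (c , i) , (c , j)

  bridge : BVertex (suc k) × BVertex (suc k)
  bridge = (fzero , fzero) , (fsuc fzero , fzero)

  private
    χ : BVertex (suc k) → BVertex (suc k) × BVertex (suc k) → ℕ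
    χ = incidence (decBV (suc k))

  copy-incidence : (c : Fin 2) (v : Fin (suc k)) (b : ℕ) →
    rankSum (χ (c , v)) b (map (inCopy c) (pairs (suc k))) ≡ rankedDegree b (suc k) v
  copy-incidence c v b = trans (rankSum-map (χ (c , v)) b (inCopy c) (pairs (suc k)))
    (rankSum-cong b (λ (i , j) → incidence-injective _≟_ (decBV (suc k)) (c ,_) ,-injectiveʳ v i j) (pairs (suc k)))

  other-copy-incidence : (c d : Fin 2) → c ≢ d → (v : Fin (suc k)) (b : ℕ) →
    rankSum (χ (c , v)) b (map (inCopy d) (pairs (suc k))) ≡ 0
  other-copy-incidence c d c≢d v b = trans (rankSum-map (χ (c , v)) b (inCopy d) (pairs (suc k)))
    (rankSum-zero b (λ (i , j) → incidence-≢ (decBV (suc k)) (c , v) (d , i) (d , j) (c≢d ∘ ,-injectiveˡ) (c≢d ∘ ,-injectiveˡ))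
                  (pairs (suc k)))

  bridge-incidence : (c : Fin 2) (v : Fin (suc k)) → rankSum (χ (c , v)) 0 (bridge ∷ []) ≡ bridgeBonus v
  bridge-incidence c v = trans (+-identityʳ _) (trans (*-identityʳ _) (cong (λ t → if t then 1 else 0) (ends c)))
    where
    same : (c : Fin 2) → does (decBV (suc k) (c , v) (c , fzero)) ≡ does (v ≟ fzero)
    same c = does-⇔ (mk⇔ ,-injectiveʳ (cong (c ,_))) (decBV (suc k) (c , v) (c , fzero)) (v ≟ fzero)
    ends : (c : Fin 2) → does (decBV (suc k) (c , v) (fzero , fzero)) ∨ does (decBV (suc k) (c , v) (fsuc fzero , fzero))
                          ≡ does (v ≟ fzero)
    ends fzero = trans (cong₂ _∨_ (same fzero) (dec-false (decBV (suc k) (fzero , v) (fsuc fzero , fzero)) (λ ())))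
                       (∨-identityʳ _)
    ends (fsuc fzero) = cong₂ _∨_ (dec-false (decBV (suc k) (fsuc fzero , v) (fzero , fzero)) (λ ())) (same (fsuc fzero))

  vertexSum-decomposition : (u : BVertex (suc k)) →
    vertexSum (barbell (suc k)) opposite u ≡
      rankSum (χ u) (edgeCount (suc k) + 1) (map (inCopy fzero) (pairs (suc k)))
      + (rankSum (χ u) 1 (map (inCopy (fsuc fzero)) (pairs (suc k))) + rankSum (χ u) 0 (bridge ∷ []))
  vertexSum-decomposition u = begin
    vertexSum (barbell (suc k)) opposite u
      ≡⟨ vertexSum-opposite (barbell (suc k)) u ⟩
    rankSum (χ u) 0 (copy₀ ++ copy₁ ++ bridge ∷ [])
      ≡⟨ rankSum-++ (χ u) 0 copy₀ (copy₁ ++ bridge ∷ []) ⟩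
    rankSum (χ u) (length (copy₁ ++ bridge ∷ [])) copy₀ + rankSum (χ u) 0 (copy₁ ++ bridge ∷ [])
      ≡⟨ cong₂ (λ l s → rankSum (χ u) l copy₀ + s) length-tail (rankSum-++ (χ u) 0 copy₁ (bridge ∷ [])) ⟩
    rankSum (χ u) (edgeCount (suc k) + 1) copy₀ + (rankSum (χ u) 1 copy₁ + rankSum (χ u) 0 (bridge ∷ [])) ∎
    where
    open ≡-Reasoning
    copy₀ copy₁ : List (BVertex (suc k) × BVertex (suc k))
    copy₀ = map (inCopy fzero) (pairs (suc k))
    copy₁ = map (inCopy (fsuc fzero)) (pairs (suc k))
    length-tail : length (copy₁ ++ bridge ∷ []) ≡ edgeCount (suc k) + 1
    length-tail = trans (length-++ copy₁) (cong (_+ 1) (length-map _ (pairs (suc k))))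

  vertexSum-copy₀ : (v : Fin (suc k)) →
    vertexSum (barbell (suc k)) opposite (fzero , v) ≡ copyScore (edgeCount (suc k) + 1) k v
  vertexSum-copy₀ v = trans (vertexSum-decomposition (fzero , v)) (cong₂ _+_
    (copy-incidence fzero v _)
    (cong₂ _+_ (other-copy-incidence fzero (fsuc fzero) (λ ()) v 1) (bridge-incidence fzero v)))

  vertexSum-copy₁ : (v : Fin (suc k)) →
    vertexSum (barbell (suc k)) opposite (fsuc fzero , v) ≡ copyScore 1 k v
  vertexSum-copy₁ v = trans (vertexSum-decomposition (fsuc fzero , v)) (cong₂ _+_
    (other-copy-incidence (fsuc fzero) fzero (λ ()) v _)
    (cong₂ _+_ (copy-incidence (fsuc fzero) v 1) (bridge-incidence (fsuc fzero) v)))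

strictlyAntitone⇒injective : {m : ℕ} (f : Fin m → ℕ) →
  (∀ u v → toℕ u < toℕ v → f v < f u) → Injective _≡_ _≡_ f
strictlyAntitone⇒injective f anti {u} {v} fu≡fv with <-cmp (toℕ u) (toℕ v)
... | tri< u<v _ _ = contradiction (sym fu≡fv) (<⇒≢ (anti u v u<v))
... | tri≈ _ u≡v _ = toℕ-injective u≡v
... | tri> _ _ v<u = contradiction fu≡fv (<⇒≢ (anti v u v<u))

Fin2×-injective : {A : Set} (f : Fin 2 × A → ℕ) →
  Injective _≡_ _≡_ (λ a → f (fzero , a)) → Injective _≡_ _≡_ (λ a → f (fsuc fzero , a)) →
  (∀ a a′ → f (fsuc fzero , a′) < f (fzero , a)) → Injective _≡_ _≡_ f
Fin2×-injective f inj₀ inj₁ sep {fzero      , a} {fzero      , a′} e = cong (fzero ,_) (inj₀ e)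
Fin2×-injective f inj₀ inj₁ sep {fsuc fzero , a} {fsuc fzero , a′} e = cong (fsuc fzero ,_) (inj₁ e)
Fin2×-injective f inj₀ inj₁ sep {fzero      , a} {fsuc fzero , a′} e = contradiction (sym e) (<⇒≢ (sep a a′))
Fin2×-injective f inj₀ inj₁ sep {fsuc fzero , a} {fzero      , a′} e = contradiction e (<⇒≢ (sep a′ a))

copyScore-strictlyAntitone : (b r : ℕ) (u v : Fin (3 + r)) → toℕ u < toℕ v →
  copyScore b (2 + r) v < copyScore b (2 + r) u
copyScore-strictlyAntitone b r u (fsuc w) u<v = begin-strict
  rankedDegree b (3 + r) (fsuc w) + 0 ≡⟨ +-identityʳ _ ⟩
  rankedDegree b (3 + r) (fsuc w)     <⟨ rankedDegree-strictlyAntitone b r u (fsuc w) u<v ⟩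
  rankedDegree b (3 + r) u            ≤⟨ m≤m+n _ (bridgeBonus u) ⟩
  rankedDegree b (3 + r) u + bridgeBonus u ∎
  where open ≤-Reasoning

copyScores-separated : (r : ℕ) (v w : Fin (3 + r)) →
  copyScore 1 (2 + r) w < copyScore (edgeCount (3 + r) + 1) (2 + r) v
copyScores-separated r v w = begin-strict
  rankedDegree 1 (3 + r) w + bridgeBonus w  ≤⟨ +-mono-≤ (rankedDegree-upper 1 (2 + r) w) (bridgeBonus≤1 w) ⟩
  (2 + r) * (1 + N) + 1                     <⟨ +-monoʳ-< ((2 + r) * (1 + N)) (s≤s (s≤s z≤n)) ⟩
  (2 + r) * (1 + N) + (2 + r)               ≡⟨ trans (+-comm _ (2 + r)) (sym (*-suc (2 + r) (1 + N))) ⟩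
  (2 + r) * (2 + N)                         ≡⟨ cong ((2 + r) *_) (trans (+-comm 2 N) (sym (+-assoc N 1 1))) ⟩
  (2 + r) * (N + 1 + 1)                     ≤⟨ rankedDegree-lower (N + 1) (2 + r) v ⟩
  rankedDegree (N + 1) (3 + r) v            ≤⟨ m≤m+n _ (bridgeBonus v) ⟩
  rankedDegree (N + 1) (3 + r) v + bridgeBonus v ∎
  where
  open ≤-Reasoning
  N : ℕ
  N = edgeCount (3 + r)

theorem3p1 : (n : ℕ) → n ≥ 3 → Antimagic (barbell n)
theorem3p1 (suc (suc (suc r))) (s≤s (s≤s (s≤s z≤n))) =
  opposite , opposite-bijective (nE (barbell (3 + r))) ,
  Fin2×-injective vertexSumAt copy₀-injective copy₁-injective copies-separated
  where
  open Barbell (2 + r)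
  vertexSumAt : BVertex (3 + r) → ℕ
  vertexSumAt = vertexSum (barbell (3 + r)) opposite
  copy₀-injective : Injective _≡_ _≡_ (λ v → vertexSumAt (fzero , v))
  copy₀-injective = strictlyAntitone⇒injective _ λ u v u<v →
    subst₂ _<_ (sym (vertexSum-copy₀ v)) (sym (vertexSum-copy₀ u)) (copyScore-strictlyAntitone _ r u v u<v)
  copy₁-injective : Injective _≡_ _≡_ (λ v → vertexSumAt (fsuc fzero , v))
  copy₁-injective = strictlyAntitone⇒injective _ λ u v u<v →
    subst₂ _<_ (sym (vertexSum-copy₁ v)) (sym (vertexSum-copy₁ u)) (copyScore-strictlyAntitone 1 r u v u<v)
  copies-separated : ∀ v w → vertexSumAt (fsuc fzero , w) < vertexSumAt (fzero , v)
  copies-separated v w =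
    subst₂ _<_ (sym (vertexSum-copy₁ w)) (sym (vertexSum-copy₀ v)) (copyScores-separated r v w)
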